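{- Let $\mathcal{A}$ be a real central hyperplane arrangement, let $c_0,c$ be chambers of $\mathcal{A}$, and let $I\subseteq\mathcal{A}$. Then $I$ is biclosed with respect to $c_0$ if and only if the symmetric difference $I\vartriangle S(c_0,c)$ is biclosed with respect to $c$.
   Context: $\mathcal{A}$ is a finite set of linear hyperplanes in $\mathbb{R}^n$; chambers are the connected components of the complement of their union. $S(d,d')$ is the set of hyperplanes separating chambers $d,d'$. For a codimension 2 intersection subspace $X$, $\mathcal{A}_X=\{H\in\mathcal{A}:H\supseteq X\}$, and for a chamber $d$ of $\mathcal{A}$, $d_X$ is the chamber of $\mathcal{A}_X$ containing $d$. Given a chamber $b$ (the reference chamber), a set $J\subseteq\mathcal{A}$ is convex with respect to $b$ if for each $H\in\mathcal{A}\setminus J$ there is a chamber $d$ with $H\in S(b,d)\subseteq\mathcal{A}\setminus J$; $J$ is 2-closed with respect to $b$ if for every codimension 2 intersection subspace $X$, $J\cap\mathcal{A}_X$ is convex in the arrangement $\mathcal{A}_X$ with respect to $b_X$; $J$ is biclosed with respect to $b$ if $J$ and $\mathcal{A}\setminus J$ are both 2-closed with respect to $b$. -}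

module Defs where

open import Level using (Level; _⊔_) renaming (suc to lsuc)
open import Algebra.Bundles using (CommutativeRing)
open import Relation.Binary.Core using (Rel)
open import Relation.Binary.Structures using (IsStrictTotalOrder)
open import Relation.Binary.PropositionalEquality using (_≢_)
open import Relation.Nullary using (¬_)
open import Relation.Unary using (Pred; _∈_; _∉_; _∩_; ∁)
open import Data.Nat using (ℕ; zero; suc)
open import Data.Fin using (Fin)
import Data.Fin as Fin
open import Data.Product using (Σ; ∃; _×_)
open import Data.Sum using (_⊎_)

-- Ordered fields (the stdlib has no real numbers; ℝ is an instance).

record OrderedField (c ℓ₁ ℓ₂ : Level) : Set (lsuc (c ⊔ ℓ₁ ⊔ ℓ₂)) where
  field
    commutativeRing : CommutativeRing c ℓ₁
  open CommutativeRing commutativeRing public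
  field
    _<_                : Rel Carrier ℓ₂
    isStrictTotalOrder : IsStrictTotalOrder _≈_ _<_
    +-mono-<           : ∀ {a b} (d : Carrier) → a < b → (a + d) < (b + d)
    *-pos              : ∀ {a b} → 0# < a → 0# < b → 0# < (a * b)
    0≉1                : ¬ (0# ≈ 1#)
    inverse            : ∀ a → ¬ (a ≈ 0#) → ∃ λ b → (a * b) ≈ 1#

module _ {c ℓ₁ ℓ₂ : Level} (F : OrderedField c ℓ₁ ℓ₂) where
  open OrderedField F

  Vect : ℕ → Set c
  Vect n = Fin n → Carrier

  dot : ∀ {n} → Vect n → Vect n → Carrier
  dot {zero}  a x = 0#
  dot {suc n} a x = (a Fin.zero * x Fin.zero) + dot (λ i → a (Fin.suc i)) (λ i → x (Fin.suc i))

  -- A central (linear) hyperplane arrangement in F^n with m hyperplanes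
  -- H_i = { x | normal i · x = 0 }, given by nonzero normals, and the
  -- hyperplanes pairwise distinct (so 𝒜 is a set of m hyperplanes).

  record Arrangement (n m : ℕ) : Set (c ⊔ ℓ₁) where
    field
      normal   : Fin m → Vect n
      proper   : ∀ i → ∃ λ (x : Vect n) → ¬ (dot (normal i) x ≈ 0#)
      distinct : ∀ i j → i ≢ j →
                 ∃ λ (x : Vect n) → (dot (normal i) x ≈ 0#) × ¬ (dot (normal j) x ≈ 0#)

  module _ {n m : ℕ} (𝒜 : Arrangement n m) where
    open Arrangement 𝒜

    OnH : Fin m → Vect n → Set ℓ₁
    OnH i x = dot (normal i) x ≈ 0#

    -- A chamber of the subarrangement P ⊆ 𝒜 is represented by any point in
    -- it, i.e. any point lying on no hyperplane of P (the chamber being the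
    -- connected component of the complement containing that point).
    ChamberPtIn : ∀ {p} → Pred (Fin m) p → Vect n → Set (p ⊔ ℓ₁)
    ChamberPtIn P x = ∀ i → i ∈ P → ¬ OnH i x

    ChamberPt : Vect n → Set ℓ₁
    ChamberPt x = ∀ i → ¬ OnH i x

    Sep : Vect n → Vect n → Pred (Fin m) ℓ₂
    Sep x y i = (dot (normal i) x * dot (normal i) y) < 0#

    SepIn : ∀ {p} → Pred (Fin m) p → Vect n → Vect n → Pred (Fin m) (p ⊔ ℓ₂)
    SepIn P x y = P ∩ Sep x y

    ConvexIn : ∀ {p q} → Pred (Fin m) p → Pred (Fin m) q → Vect n →
               Set (c ⊔ ℓ₁ ⊔ ℓ₂ ⊔ p ⊔ q)
    ConvexIn P J b =
      ∀ H → H ∈ P → H ∉ J →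
      Σ (Vect n) λ d → ChamberPtIn P d × H ∈ SepIn P b d ×
        (∀ H′ → H′ ∈ SepIn P b d → (H′ ∈ P × H′ ∉ J))

    -- 𝒜_X for the codimension-2 subspace X = H_i ∩ H_j (i ≢ j):
    -- the hyperplanes containing X.
    𝒜X : Fin m → Fin m → Pred (Fin m) (c ⊔ ℓ₁)
    𝒜X i j k = ∀ (x : Vect n) → OnH i x → OnH j x → OnH k x

    TwoClosed : ∀ {q} → Pred (Fin m) q → Vect n → Set (c ⊔ ℓ₁ ⊔ ℓ₂ ⊔ q)
    TwoClosed J b = ∀ i j → i ≢ j → ConvexIn (𝒜X i j) (J ∩ 𝒜X i j) b

    Biclosed : ∀ {q} → Pred (Fin m) q → Vect n → Set (c ⊔ ℓ₁ ⊔ ℓ₂ ⊔ q)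
    Biclosed J b = TwoClosed J b × TwoClosed (∁ J) b

    _∆_ : ∀ {p q} → Pred (Fin m) p → Pred (Fin m) q → Pred (Fin m) (p ⊔ q)
    (I ∆ J) H = (H ∈ I × H ∉ J) ⊎ (H ∉ I × H ∈ J)

module Submission where

-- Biclosedness is a condition on the pencils 𝒜_X (X = H_i ∩ H_j), and the
-- proof rests on a description of biclosed sets of a pencil: J ∩ 𝒜_X and its
-- complement are both convex from b iff J ∩ 𝒜_X = S_X(b,d) for a chamber d
-- of 𝒜_X.  One direction is immediate (d and its antipode are the
-- witnesses).  The other is rank-two combinatorics: the hyperplanes of a
-- pencil are linearly (pre)ordered by angle as seen from b, every separation
-- set is an initial or a final segment, and a segment J such that J and its
-- complement are unions of separation sets is itself one (RankTwo).  The
-- angular order comes from the three-term Plücker relation among the forms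
-- of a pencil (Pencil).  Once biclosed sets are "pencilwise separation
-- sets", the lemma is the identity S(c,d) = S(c₀,c) ∆ S(c₀,d) (Biclosure).

open import Defs
open import Level using (Level; _⊔_) renaming (suc to lsuc)
open import Data.Nat using (ℕ; zero; suc)
open import Data.Fin using (Fin) renaming (zero to fzero; suc to fsuc)
open import Data.Fin.Properties using (all?; any?)
open import Data.Fin.Subset using (Subset; _∈_)
open import Data.Fin.Subset.Properties using (_∈?_)
open import Data.List using (List; []; _∷_; allFin)
open import Data.List.Relation.Unary.Any using (here; there)
import Data.List.Membership.Propositional as List
open import Data.List.Membership.Propositional.Properties using (∈-allFin)
open import Data.Product using (Σ; _×_; _,_; proj₁; proj₂)
open import Data.Sum using (_⊎_; inj₁; inj₂; [_,_]′)
open import Data.Empty using (⊥; ⊥-elim)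
open import Function.Bundles using (_⇔_; mk⇔; Equivalence)
open import Function.Construct.Composition using (_⇔-∘_)
open import Function.Construct.Symmetry using (⇔-sym)
open import Relation.Nullary using (¬_; Dec; yes; no)
open import Relation.Nullary.Decidable using (_→-dec_; _×-dec_; _⊎-dec_; ¬?; map′; decidable-stable)
open import Relation.Unary using (Pred; Decidable; _∩_; ∁)
open import Relation.Binary.PropositionalEquality using (_≢_) renaming (sym to ≡-sym)
open import Relation.Binary.Definitions using (tri<; tri≈; tri>)
open import Relation.Binary.Structures using (IsStrictTotalOrder)
import Algebra.Solver.Ring.NaturalCoefficients.Default as Solver
import Algebra.Properties.Ring as RingProperties

module ExclusiveOr where
  _⊕_ : ∀ {a b} → Set a → Set b → Set (a ⊔ b)
  X ⊕ Y = (X × ¬ Y) ⊎ (¬ X × Y)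

  ⊕-shift : ∀ {a e j} {A : Set a} {E : Set e} {J : Set j} → J ⇔ E → (J ⊕ A) ⇔ (A ⊕ E)
  ⊕-shift {A = A} {E} {J} J⇔E = mk⇔ forward backward
    where
    open Equivalence J⇔E
    forward : J ⊕ A → A ⊕ E
    forward (inj₁ (j , ¬a)) = inj₂ (¬a , to j)
    forward (inj₂ (¬j , a)) = inj₁ (a , λ e → ¬j (from e))
    backward : A ⊕ E → J ⊕ A
    backward (inj₁ (a , ¬e)) = inj₂ ((λ j → ¬e (to j)) , a)
    backward (inj₂ (¬a , e)) = inj₁ (from e , ¬a)

  ⊕-unshift : ∀ {a e j} {A : Set a} {E : Set e} {J : Set j} → Dec A → Dec E → Dec J →
              (J ⊕ A) ⇔ (A ⊕ E) → J ⇔ E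
  ⊕-unshift {A = A} {E} {J} A? E? J? J⊕A⇔A⊕E = mk⇔ (to′ A? E?) (from′ J? A?)
    where
    open Equivalence J⊕A⇔A⊕E
    to′ : Dec A → Dec E → J → E
    to′ _       (yes e) j = e
    to′ (yes a) (no ¬e) j =
      [ (λ (_ , ¬a) → ⊥-elim (¬a a)) , (λ (¬j , _) → ⊥-elim (¬j j)) ]′ (from (inj₁ (a , ¬e)))
    to′ (no ¬a) (no ¬e) j =
      [ (λ (a , _) → ⊥-elim (¬a a)) , (λ (_ , e) → e) ]′ (to (inj₁ (j , ¬a)))
    from′ : Dec J → Dec A → E → J
    from′ (yes j) _       e = j
    from′ (no ¬j) (yes a) e =
      [ (λ (_ , ¬e) → ⊥-elim (¬e e)) , (λ (¬a , _) → ⊥-elim (¬a a)) ]′ (to (inj₂ (¬j , a)))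
    from′ (no ¬j) (no ¬a) e =
      [ (λ (j , _) → ⊥-elim (¬j j)) , (λ (_ , a) → ⊥-elim (¬a a)) ]′ (from (inj₂ (¬a , e)))

module OrderedFieldFacts {c ℓ₁ ℓ₂ : Level} (F : OrderedField c ℓ₁ ℓ₂) where
  open OrderedField F
  open ExclusiveOr using (_⊕_)
  open Solver commutativeSemiring public using (solve; _:=_; _:+_; _:*_)
  open IsStrictTotalOrder isStrictTotalOrder public
    using (compare; _<?_; _≟_) renaming (trans to <-trans; irrefl to <-irrefl; asym to <-asym;
           <-respʳ-≈ to <-respʳ; <-respˡ-≈ to <-respˡ)
  open RingProperties ring public
    using (-‿distribˡ-*; -‿distribʳ-*; -‿involutive; -0#≈0#; -‿+-comm; +-cancelʳ;
           [y-z]x≈yx-zx; x∙y⁻¹≈ε⇒x≈y)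

  neg⇒-pos : ∀ {a} → a < 0# → 0# < (- a)
  neg⇒-pos {a} p = <-respʳ (+-identityˡ (- a)) (<-respˡ (-‿inverseʳ a) (+-mono-< (- a) p))

  -pos⇒neg : ∀ {a} → 0# < (- a) → a < 0#
  -pos⇒neg {a} p = <-respʳ (-‿inverseˡ a) (<-respˡ (+-identityˡ a) (+-mono-< a p))

  pos⇒-neg : ∀ {a} → 0# < a → (- a) < 0#
  pos⇒-neg {a} p = <-respʳ (-‿inverseʳ a) (<-respˡ (+-identityˡ (- a)) (+-mono-< (- a) p))

  -neg⇒pos : ∀ {a} → (- a) < 0# → 0# < a
  -neg⇒pos {a} p = <-respʳ (+-identityˡ a) (<-respˡ (-‿inverseˡ a) (+-mono-< a p))

  neg*pos : ∀ {a b} → a < 0# → 0# < b → (a * b) < 0#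
  neg*pos {a} {b} p q = -pos⇒neg (<-respʳ (sym (-‿distribˡ-* a b)) (*-pos (neg⇒-pos p) q))

  pos*neg : ∀ {a b} → 0# < a → b < 0# → (a * b) < 0#
  pos*neg {a} {b} p q = <-respˡ (*-comm b a) (neg*pos q p)

  neg*neg : ∀ {a b} → a < 0# → b < 0# → 0# < (a * b)
  neg*neg {a} {b} p q = <-respʳ (-neg*neg) (*-pos (neg⇒-pos p) (neg⇒-pos q))
    where
    -neg*neg : (- a) * (- b) ≈ a * b
    -neg*neg = trans (sym (-‿distribˡ-* a (- b)))
                 (trans (-‿cong (sym (-‿distribʳ-* a b))) (-‿involutive (a * b)))

  nonzero-sign : ∀ {a} → ¬ (a ≈ 0#) → a < 0# ⊎ 0# < a
  nonzero-sign {a} a≉0 with compare a 0#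
  ... | tri< p _ _ = inj₁ p
  ... | tri≈ _ e _ = ⊥-elim (a≉0 e)
  ... | tri> _ _ p = inj₂ p

  nonneg-nonzero⇒pos : ∀ {a} → ¬ (a < 0#) → ¬ (a ≈ 0#) → 0# < a
  nonneg-nonzero⇒pos a≮0 a≉0 with nonzero-sign a≉0
  ... | inj₁ p = ⊥-elim (a≮0 p)
  ... | inj₂ p = p

  square-pos : ∀ {a} → ¬ (a ≈ 0#) → 0# < (a * a)
  square-pos a≉0 with nonzero-sign a≉0
  ... | inj₁ p = neg*neg p p
  ... | inj₂ p = *-pos p p

  square-nonneg : ∀ a → ¬ ((a * a) < 0#)
  square-nonneg a q with compare a 0#
  ... | tri< p _ _ = <-asym (neg*neg p p) q
  ... | tri≈ _ e _ = <-irrefl (trans (*-cong e refl) (zeroˡ a)) q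
  ... | tri> _ _ p = <-asym (*-pos p p) q

  -nonzero : ∀ {a} → ¬ (a ≈ 0#) → ¬ ((- a) ≈ 0#)
  -nonzero {a} a≉0 e = a≉0 (trans (sym (-‿involutive a)) (trans (-‿cong e) -0#≈0#))

  nonzero*nonzero : ∀ {a b} → ¬ (a ≈ 0#) → ¬ (b ≈ 0#) → ¬ (a * b ≈ 0#)
  nonzero*nonzero a≉0 b≉0 e with nonzero-sign a≉0 | nonzero-sign b≉0
  ... | inj₁ p | inj₁ q = <-irrefl (sym e) (neg*neg p q)
  ... | inj₁ p | inj₂ q = <-irrefl e (neg*pos p q)
  ... | inj₂ p | inj₁ q = <-irrefl e (pos*neg p q)
  ... | inj₂ p | inj₂ q = <-irrefl (sym e) (*-pos p q)

  pos-factor-neg : ∀ {a x} → 0# < a → (a * x) < 0# → x < 0#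
  pos-factor-neg {a} {x} p q with compare x 0#
  ... | tri< r _ _ = r
  ... | tri≈ _ e _ = ⊥-elim (<-irrefl (trans (*-cong refl e) (zeroʳ a)) q)
  ... | tri> _ _ r = ⊥-elim (<-asym (*-pos p r) q)

  product-neg⇒one-neg : ∀ {x y} → ¬ (x ≈ 0#) → ¬ (y ≈ 0#) → (x * y) < 0# → ((x < 0#) ⊕ (y < 0#))
  product-neg⇒one-neg x≉0 y≉0 q with nonzero-sign x≉0 | nonzero-sign y≉0
  ... | inj₁ p | inj₁ r = ⊥-elim (<-asym (neg*neg p r) q)
  ... | inj₁ p | inj₂ r = inj₁ (p , <-asym r)
  ... | inj₂ p | inj₁ r = inj₂ (<-asym p , r)
  ... | inj₂ p | inj₂ r = ⊥-elim (<-asym (*-pos p r) q)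

  one-neg⇒product-neg : ∀ {x y} → ¬ (x ≈ 0#) → ¬ (y ≈ 0#) → ((x < 0#) ⊕ (y < 0#)) → (x * y) < 0#
  one-neg⇒product-neg x≉0 y≉0 (inj₁ (p , r)) = neg*pos p (nonneg-nonzero⇒pos r y≉0)
  one-neg⇒product-neg x≉0 y≉0 (inj₂ (p , r)) = pos*neg (nonneg-nonzero⇒pos p x≉0) r

  private
    cancel : ∀ u v → (u - v) + v ≈ u
    cancel u v = trans (+-assoc u (- v) v) (trans (+-cong refl (-‿inverseˡ v)) (+-identityʳ u))

    difference-pos : ∀ {u v} → u < v → 0# < (v - u)
    difference-pos {u} p = <-respˡ (-‿inverseʳ u) (+-mono-< (- u) p)

    difference-neg : ∀ {u v} → (v - u) < 0# → v < u
    difference-neg {u} {v} p = <-respʳ (+-identityˡ u) (<-respˡ (cancel v u) (+-mono-< u p))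

  *-monoˡ-<-pos : ∀ {x y z} → x < y → 0# < z → (x * z) < (y * z)
  *-monoˡ-<-pos {x} {y} {z} p q =
    <-respʳ (cancel (y * z) (x * z))
      (<-respˡ (+-identityˡ (x * z))
        (+-mono-< (x * z) (<-respʳ ([y-z]x≈yx-zx z y x) (*-pos (difference-pos p) q))))

  *-monoˡ-<-neg : ∀ {x y z} → x < y → z < 0# → (y * z) < (x * z)
  *-monoˡ-<-neg {x} {y} {z} p q =
    difference-neg (<-respˡ ([y-z]x≈yx-zx z y x) (pos*neg (difference-pos p) q))

  _≤_ : Carrier → Carrier → Set (ℓ₁ ⊔ ℓ₂)
  a ≤ b = a < b ⊎ a ≈ b

  *-monoˡ-≤-pos : ∀ {x y z} → x ≤ y → 0# < z → (x * z) ≤ (y * z)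
  *-monoˡ-≤-pos (inj₁ p) q = inj₁ (*-monoˡ-<-pos p q)
  *-monoˡ-≤-pos (inj₂ e) q = inj₂ (*-cong e refl)

  +-mono-<-≤-< : ∀ {x₁ x₂ x₃ y₁ y₂ y₃} → y₁ < x₁ → y₂ ≤ x₂ → y₃ < x₃ →
                 ((y₁ + y₂) + y₃) < ((x₁ + x₂) + x₃)
  +-mono-<-≤-< p q r = +-mono₂ (+-mono-<-≤ p q) r
    where
    +-mono₂ : ∀ {a b d e} → a < b → d < e → (a + d) < (b + e)
    +-mono₂ {a} {b} {d} {e} p q =
      <-trans (+-mono-< d p) (<-respˡ (+-comm d b) (<-respʳ (+-comm e b) (+-mono-< b q)))
    +-mono-<-≤ : ∀ {a b d e} → a < b → d ≤ e → (a + d) < (b + e)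
    +-mono-<-≤ p (inj₁ q) = +-mono₂ p q
    +-mono-<-≤ {d = d} p (inj₂ q) = <-respʳ (+-cong refl q) (+-mono-< d p)

-- Combinatorics of a rank-two subarrangement.  Its hyperplanes carry an
-- angular (pre)order ≺ such that, seen from a base chamber, every chamber is
-- separated from it by an initial or final segment (no pattern out-in-out or
-- in-out-in along ≺).  Everything here is purely order-theoretic.
module RankTwo where
  open import Relation.Binary.PropositionalEquality using (refl)

  record AngularOrder (m : ℕ) (lp lt ls lr : Level) : Set (lsuc (lp ⊔ lt ⊔ ls ⊔ lr)) where
    field
      -- the hyperplanes of the subarrangement
      P   : Fin m → Set lp
      P?  : ∀ k → Dec (P k)
      -- its chambers; S d k says that k separates the base chamber from d
      Chamber : Set lt
      S   : Chamber → Fin m → Set ls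
      S?  : ∀ d k → Dec (S d k)
      -- the strict angular order and its trichotomy up to hyperplanes that
      -- no chamber can tell apart
      _≺_ : Fin m → Fin m → Set lr
      _≺?_ : ∀ k l → Dec (k ≺ l)
      trichotomy : ∀ k l → P k → P l →
                   k ≺ l ⊎ (l ≺ k ⊎ (∀ d → (S d k → S d l) × (S d l → S d k)))
      no-out-in-out : ∀ d k l n → P k → P l → P n → k ≺ l → l ≺ n →
                      ¬ S d k → S d l → ¬ S d n → ⊥
      no-in-out-in  : ∀ d k l n → P k → P l → P n → k ≺ l → l ≺ n →
                      S d k → ¬ S d l → S d n → ⊥
      base          : Chamber
      base-empty    : ∀ k → P k → ¬ S base k
      opposite      : Chamber
      opposite-full : ∀ k → P k → S opposite k

  reverse : ∀ {m lp lt ls lr} → AngularOrder m lp lt ls lr → AngularOrder m lp lt ls lr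
  reverse s = record
    { P = P ; P? = P? ; Chamber = Chamber ; S = S ; S? = S?
    ; _≺_ = λ k l → l ≺ k ; _≺?_ = λ k l → l ≺? k
    ; trichotomy = λ k l pk pl → swap (trichotomy k l pk pl)
    ; no-out-in-out = λ d k l n pk pl pn r₁ r₂ a b c → no-out-in-out d n l k pn pl pk r₂ r₁ c b a
    ; no-in-out-in  = λ d k l n pk pl pn r₁ r₂ a b c → no-in-out-in d n l k pn pl pk r₂ r₁ c b a
    ; base = base ; base-empty = base-empty ; opposite = opposite ; opposite-full = opposite-full }
    where
    open AngularOrder s
    swap : ∀ {a b c} {A : Set a} {B : Set b} {C : Set c} → A ⊎ (B ⊎ C) → B ⊎ (A ⊎ C)
    swap (inj₁ a) = inj₂ (inj₁ a)
    swap (inj₂ (inj₁ b)) = inj₁ b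
    swap (inj₂ (inj₂ c)) = inj₂ (inj₂ c)

  module Segments {m lp lt ls lr} (s : AngularOrder m lp lt ls lr) where
    open AngularOrder s

    Initial : ∀ {lx} → (Fin m → Set lx) → Set (lp ⊔ lr ⊔ lx)
    Initial X = ∀ k l → P k → P l → k ≺ l → X l → X k

    Final : ∀ {lx} → (Fin m → Set lx) → Set (lp ⊔ lr ⊔ lx)
    Final X = ∀ k l → P k → P l → k ≺ l → X k → X l

    initial-or-final : ∀ {lx} (X : Fin m → Set lx) → (∀ k → Dec (X k)) →
      (∀ {k l k′ l′} → P k → P l → P k′ → P l′ →
         k ≺ l → X l → ¬ X k → k′ ≺ l′ → X k′ → ¬ X l′ → ⊥) →
      Initial X ⊎ Final X
    initial-or-final X X? no-crossing with initial?
      where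
      initial? : Dec (Initial X)
      initial? = all? λ k → all? λ l →
        P? k →-dec (P? l →-dec ((k ≺? l) →-dec (X? l →-dec X? k)))
    ... | yes initial = inj₁ initial
    ... | no ¬initial = inj₂ final
      where
      final : Final X
      final k′ l′ pk′ pl′ r′ xk′ with X? l′
      ... | yes xl′ = xl′
      ... | no ¬xl′ = ⊥-elim (¬initial initial)
        where
        initial : Initial X
        initial k l pk pl r xl with X? k
        ... | yes xk = xk
        ... | no ¬xk = ⊥-elim (no-crossing pk pl pk′ pl′ r xl ¬xk r′ xk′ ¬xl′)

    separation-segment : ∀ d → Initial (S d) ⊎ Final (S d)
    separation-segment d = initial-or-final (S d) (S? d) crossing
      where
      crossing : ∀ {k l k′ l′} → P k → P l → P k′ → P l′ →
                 k ≺ l → S d l → ¬ S d k → k′ ≺ l′ → S d k′ → ¬ S d l′ → ⊥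
      crossing {k} {l} {k′} {l′} pk pl pk′ pl′ r sl ¬sk r′ sk′ ¬sl′ with trichotomy l l′ pl pl′
      ... | inj₁ l≺l′        = no-out-in-out d k l l′ pk pl pl′ r l≺l′ ¬sk sl ¬sl′
      ... | inj₂ (inj₁ l′≺l) = no-in-out-in d k′ l′ l pk′ pl′ pl r′ l′≺l sk′ ¬sl′ sl
      ... | inj₂ (inj₂ tied) = ¬sl′ (proj₁ (tied d) sl)

    _⊆ᴾ_ : ∀ {lx ly} → (Fin m → Set lx) → (Fin m → Set ly) → Set (lp ⊔ lx ⊔ ly)
    X ⊆ᴾ Y = ∀ H → P H → X H → Y H

    -- J is a union of separation sets (within the subarrangement): each of its
    -- hyperplanes is separated from the base by a chamber whose whole
    -- separation set lies in J.
    Covered : ∀ {lj} → (Fin m → Set lj) → Set (lp ⊔ lt ⊔ ls ⊔ lj)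
    Covered J = ∀ H → P H → J H → Σ Chamber λ d → S d H × (S d ⊆ᴾ J)

    covered-segment : ∀ {lj} (J : Fin m → Set lj) → (∀ k → Dec (J k)) →
      Covered J → Covered (λ H → ¬ J H) → Initial J ⊎ Final J
    covered-segment J J? covJ cov∁J = initial-or-final J J? crossing
      where
      crossing : ∀ {y x x′ y′} → P y → P x → P x′ → P y′ →
                 y ≺ x → J x → ¬ J y → x′ ≺ y′ → J x′ → ¬ J y′ → ⊥
      crossing {y} {x} {x′} {y′} py px px′ py′ r jx ¬jy r′ jx′ ¬jy′
        with cov∁J y py ¬jy | covJ x′ px′ jx′
      ... | (dy , sy , outside) | (dx , sx , inside)
        with separation-segment dy | separation-segment dx
      ... | inj₂ final-y | _ = outside x px (final-y y x py px r sy) jx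
      ... | inj₁ _ | inj₂ final-x = ¬jy′ (inside y′ py′ (final-x x′ y′ px′ py′ r′ sx))
      ... | inj₁ initial-y | inj₁ initial-x with trichotomy x′ y px′ py
      ... | inj₁ x′≺y = outside x′ px′ (initial-y x′ y px′ py x′≺y sy) jx′
      ... | inj₂ (inj₁ y≺x′) = ¬jy (inside y py (initial-x y x′ py px′ y≺x′ sx))
      ... | inj₂ (inj₂ tied) = outside x′ px′ (proj₂ (tied dy) sy) jx′

    SeparatesExactly : ∀ {lj} → Chamber → (Fin m → Set lj) → Set (lp ⊔ ls ⊔ lj)
    SeparatesExactly d J = (J ⊆ᴾ S d) × (S d ⊆ᴾ J)

    nested : ∀ d e x → P x → Initial (S d) → ¬ S d x → Initial (S e) → S e x → S d ⊆ᴾ S e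
    nested d e x px initial-d ¬sdx initial-e sex H pH sdH with trichotomy H x pH px
    ... | inj₁ H≺x = initial-e H x pH px H≺x sex
    ... | inj₂ (inj₁ x≺H) = ⊥-elim (¬sdx (initial-d x H px pH x≺H sdH))
    ... | inj₂ (inj₂ tied) = ⊥-elim (¬sdx (proj₁ (tied d) sdH))

    -- For an initial segment J, covered by separation sets and missing some
    -- hyperplane y₀ of the subarrangement, a separation set equal to J is
    -- grown hyperplane by hyperplane through initial separation sets inside J.
    module Growth {lj} (J : Fin m → Set lj) (J? : ∀ k → Dec (J k)) (covJ : Covered J)
                  (initial : Initial J) (y₀ : Fin m) (py₀ : P y₀) (¬jy₀ : ¬ J y₀) where

      -- Since y₀ ∉ J, a chamber covering some H ∈ J cannot have a final
      -- separation set.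
      initial-cover : ∀ H → P H → J H → Σ Chamber λ e → S e H × (S e ⊆ᴾ J) × Initial (S e)
      initial-cover H pH jH with covJ H pH jH
      ... | e , se , sub with separation-segment e
      ... | inj₁ initial-e = e , se , sub , initial-e
      ... | inj₂ final-e with trichotomy H y₀ pH py₀
      ... | inj₁ H≺y₀ = ⊥-elim (¬jy₀ (sub y₀ py₀ (final-e H y₀ pH py₀ H≺y₀ se)))
      ... | inj₂ (inj₁ y₀≺H) = ⊥-elim (¬jy₀ (initial y₀ H py₀ pH y₀≺H jH))
      ... | inj₂ (inj₂ tied) = ⊥-elim (¬jy₀ (sub y₀ py₀ (proj₁ (tied e) se)))

      Approximation : List (Fin m) → Set (lp ⊔ lt ⊔ ls ⊔ lr ⊔ lj)
      Approximation xs = Σ Chamber λ d → (S d ⊆ᴾ J) × Initial (S d) ×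
                         (∀ H → H List.∈ xs → P H → J H → S d H)

      grow : ∀ xs → Approximation xs
      grow [] = base , (λ H pH s → ⊥-elim (base-empty H pH s))
                     , (λ k l pk pl r s → ⊥-elim (base-empty l pl s)) , (λ H ())
      grow (x ∷ xs) with grow xs
      ... | d , sub , initial-d , covers with P? x ×-dec J? x | S? d x
      ... | no ¬pjx | _ = d , sub , initial-d , covers′
        where
        covers′ : ∀ H → H List.∈ (x ∷ xs) → P H → J H → S d H
        covers′ H (here refl) pH jH = ⊥-elim (¬pjx (pH , jH))
        covers′ H (there h) = covers H h
      ... | yes _ | yes sdx = d , sub , initial-d , covers′
        where
        covers′ : ∀ H → H List.∈ (x ∷ xs) → P H → J H → S d H
        covers′ H (here refl) _ _ = sdx
        covers′ H (there h) = covers H h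
      ... | yes (px , jx) | no ¬sdx with initial-cover x px jx
      ... | e , sex , sub-e , initial-e = e , sub-e , initial-e , covers′
        where
        covers′ : ∀ H → H List.∈ (x ∷ xs) → P H → J H → S e H
        covers′ H (here refl) _ _ = sex
        covers′ H (there h) pH jH =
          nested d e x px initial-d ¬sdx initial-e sex H pH (covers H h pH jH)

    -- An initial segment J which is a union of separation sets is itself a
    -- separation set: the opposite chamber if J is the whole subarrangement,
    -- and the result of Growth over all hyperplanes otherwise.
    initial-separation-set : ∀ {lj} (J : Fin m → Set lj) → (∀ k → Dec (J k)) →
      Covered J → Initial J → Σ Chamber λ d → SeparatesExactly d J
    initial-separation-set J J? covJ initial with any? (λ y → P? y ×-dec ¬? (J? y))
    ... | no none = opposite , (λ H pH _ → opposite-full H pH) , all-in-J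
      where
      all-in-J : S opposite ⊆ᴾ J
      all-in-J H pH _ = decidable-stable (J? H) (λ ¬jH → none (H , pH , ¬jH))
    ... | yes (y₀ , py₀ , ¬jy₀) =
      let (d , sub , _ , covers) = Growth.grow J J? covJ initial y₀ py₀ ¬jy₀ (allFin m)
      in d , (λ H pH jH → covers H (∈-allFin H) pH jH) , sub

  covered-separation-set : ∀ {m lp lt ls lr} (s : AngularOrder m lp lt ls lr)
    {lj} (J : Fin m → Set lj) → (∀ k → Dec (J k)) →
    Segments.Covered s J → Segments.Covered s (λ H → ¬ J H) →
    Σ (AngularOrder.Chamber s) λ d → Segments.SeparatesExactly s d J
  covered-separation-set s J J? covJ cov∁J with Segments.covered-segment s J J? covJ cov∁J
  ... | inj₁ initial = Segments.initial-separation-set s J J? covJ initial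
  ... | inj₂ final   = Segments.initial-separation-set (reverse s) J J? covJ
                         (λ k l pk pl r → final l k pl pk r)

module DotProduct {c ℓ₁ ℓ₂ : Level} (F : OrderedField c ℓ₁ ℓ₂) where
  open OrderedField F
  open OrderedFieldFacts F using (solve; _:=_; _:+_; _:*_; -‿distribʳ-*; -‿+-comm; -0#≈0#)

  private
    tail : ∀ {n} → Vect F (suc n) → Vect F n
    tail x t = x (fsuc t)

  dot-cong : ∀ {n} {a a′ x x′ : Vect F n} → (∀ t → a t ≈ a′ t) → (∀ t → x t ≈ x′ t) →
             dot F a x ≈ dot F a′ x′
  dot-cong {zero}  ea ex = refl
  dot-cong {suc n} ea ex = +-cong (*-cong (ea fzero) (ex fzero)) (dot-cong (λ t → ea (fsuc t)) (λ t → ex (fsuc t)))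

  dot-comm : ∀ {n} (a x : Vect F n) → dot F a x ≈ dot F x a
  dot-comm {zero}  a x = refl
  dot-comm {suc n} a x = +-cong (*-comm (a fzero) (x fzero)) (dot-comm (tail a) (tail x))

  dot-+ : ∀ {n} (a x y : Vect F n) → dot F a (λ t → x t + y t) ≈ dot F a x + dot F a y
  dot-+ {zero}  a x y = sym (+-identityˡ 0#)
  dot-+ {suc n} a x y =
    trans (+-cong refl (dot-+ (tail a) (tail x) (tail y)))
          (solve 5 (λ a₀ x₀ y₀ u v → a₀ :* (x₀ :+ y₀) :+ (u :+ v) := (a₀ :* x₀ :+ u) :+ (a₀ :* y₀ :+ v))
                 refl (a fzero) (x fzero) (y fzero) _ _)

  dot-* : ∀ {n} (a x : Vect F n) p → dot F a (λ t → p * x t) ≈ p * dot F a x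
  dot-* {zero}  a x p = sym (zeroʳ p)
  dot-* {suc n} a x p =
    trans (+-cong refl (dot-* (tail a) (tail x) p))
          (solve 4 (λ a₀ x₀ p u → a₀ :* (p :* x₀) :+ p :* u := p :* (a₀ :* x₀ :+ u))
                 refl (a fzero) (x fzero) p _)

  dot-- : ∀ {n} (a x : Vect F n) → dot F a (λ t → - x t) ≈ - dot F a x
  dot-- {zero}  a x = sym -0#≈0#
  dot-- {suc n} a x =
    trans (+-cong (sym (-‿distribʳ-* (a fzero) (x fzero))) (dot-- (tail a) (tail x))) (-‿+-comm _ _)

  dot-difference : ∀ {n} (a x y : Vect F n) → dot F a (λ t → x t - y t) ≈ dot F a x - dot F a y
  dot-difference a x y = trans (dot-+ a x (λ t → - y t)) (+-cong refl (dot-- a y))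

  dot-linearʳ : ∀ {n} (a x y : Vect F n) p q →
                dot F a (λ t → p * x t + q * y t) ≈ p * dot F a x + q * dot F a y
  dot-linearʳ a x y p q = trans (dot-+ a _ _) (+-cong (dot-* a x p) (dot-* a y q))

  dot-linearˡ : ∀ {n} (a e x : Vect F n) p q →
                dot F (λ t → p * a t + q * e t) x ≈ p * dot F a x + q * dot F e x
  dot-linearˡ a e x p q =
    trans (dot-comm _ x)
      (trans (dot-linearʳ x a e p q) (+-cong (*-cong refl (dot-comm x a)) (*-cong refl (dot-comm x e))))

  dot-zero : ∀ {n} (a : Vect F n) → dot F a (λ _ → 0#) ≈ 0#
  dot-zero {zero}  a = refl
  dot-zero {suc n} a = trans (+-cong (zeroʳ (a fzero)) (dot-zero (tail a))) (+-identityˡ 0#)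

  unit : ∀ {n} → Fin n → Vect F n
  unit fzero    fzero    = 1#
  unit fzero    (fsuc s) = 0#
  unit (fsuc t) fzero    = 0#
  unit (fsuc t) (fsuc s) = unit t s

  dot-unit : ∀ {n} (a : Vect F n) t → dot F a (unit t) ≈ a t
  dot-unit {suc n} a fzero    = trans (+-cong (*-identityʳ (a fzero)) (dot-zero (tail a))) (+-identityʳ (a fzero))
  dot-unit {suc n} a (fsuc t) = trans (+-cong (zeroʳ (a fzero)) (dot-unit (tail a) t)) (+-identityˡ _)

module Separation {c ℓ₁ ℓ₂ : Level} (F : OrderedField c ℓ₁ ℓ₂) {n m : ℕ} (𝒜 : Arrangement F n m) where
  open OrderedField F
  open OrderedFieldFacts F
  open DotProduct F
  open ExclusiveOr using (_⊕_)
  open Arrangement 𝒜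

  form : Fin m → Vect F n → Carrier
  form k x = dot F (normal k) x

  antipode : Vect F n → Vect F n
  antipode x t = - x t

  form-antipode : ∀ k x → form k (antipode x) ≈ - form k x
  form-antipode k x = dot-- (normal k) x

  antipode-chamber : ∀ {p} {P : Fin m → Set p} {x} → ChamberPtIn F 𝒜 P x → ChamberPtIn F 𝒜 P (antipode x)
  antipode-chamber {x = x} chx k pk e = -nonzero (chx k pk) (trans (sym (form-antipode k x)) e)

  sep-irrefl : ∀ x k → ¬ Sep F 𝒜 x x k
  sep-irrefl x k = square-nonneg (form k x)

  private
    form-product-antipode : ∀ k x y → (form k x * form k (antipode y)) ≈ (- (form k x * form k y))
    form-product-antipode k x y = trans (*-cong refl (form-antipode k y)) (sym (-‿distribʳ-* _ _))

  sep-antipode : ∀ x k → ¬ (form k x ≈ 0#) → Sep F 𝒜 x (antipode x) k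
  sep-antipode x k x∉H = <-respˡ (sym (form-product-antipode k x x)) (pos⇒-neg (square-pos x∉H))

  sep-antipode⇒¬sep : ∀ x y k → Sep F 𝒜 x (antipode y) k → ¬ Sep F 𝒜 x y k
  sep-antipode⇒¬sep x y k p = <-asym (-neg⇒pos (<-respˡ (form-product-antipode k x y) p))

  ¬sep⇒sep-antipode : ∀ x y k → ¬ (form k x ≈ 0#) → ¬ (form k y ≈ 0#) →
                      ¬ Sep F 𝒜 x y k → Sep F 𝒜 x (antipode y) k
  ¬sep⇒sep-antipode x y k x∉H y∉H ¬sep =
    <-respˡ (sym (form-product-antipode k x y))
      (pos⇒-neg (nonneg-nonzero⇒pos ¬sep (nonzero*nonzero x∉H y∉H)))

  private
    regroup : ∀ p q r → ((p * q) * (p * r)) ≈ ((p * p) * (q * r))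
    regroup = solve 3 (λ p q r → (p :* q) :* (p :* r) := (p :* p) :* (q :* r)) refl

  sep⇔⊕ : ∀ b x y k → ¬ (form k b ≈ 0#) → ¬ (form k x ≈ 0#) → ¬ (form k y ≈ 0#) →
          Sep F 𝒜 x y k ⇔ (Sep F 𝒜 b x k ⊕ Sep F 𝒜 b y k)
  sep⇔⊕ b x y k b∉H x∉H y∉H = mk⇔
    (λ s → product-neg⇒one-neg (nonzero*nonzero b∉H x∉H) (nonzero*nonzero b∉H y∉H)
             (<-respˡ (sym (regroup _ _ _)) (pos*neg (square-pos b∉H) s)))
    (λ h → pos-factor-neg (square-pos b∉H)
             (<-respˡ (regroup _ _ _) (one-neg⇒product-neg (nonzero*nonzero b∉H x∉H) (nonzero*nonzero b∉H y∉H) h)))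

-- The hyperplanes through a codimension-two subspace X = H_i ∩ H_j form a
-- pencil: each of their forms is a combination α_k f_i + β_k f_j.  Seen from a
-- chamber b, the pencil is angularly ordered by the sign of the 2×2
-- determinants of the rescaled coefficients, and this order satisfies the
-- axioms of RankTwo.AngularOrder.
module Pencil {c ℓ₁ ℓ₂ : Level} (F : OrderedField c ℓ₁ ℓ₂) {n m : ℕ} (𝒜 : Arrangement F n m)
              (i j : Fin m) (i≢j : i ≢ j) where
  open OrderedField F
  open OrderedFieldFacts F
  open DotProduct F
  open Separation F 𝒜
  open Arrangement 𝒜

  OnX : Fin m → Set (c ⊔ ℓ₁)
  OnX = 𝒜X F 𝒜 i j

  -- Since H_k ≠ H_l, some vector is on H_l but off H_k; rescaled, it is dual
  -- to the pair (k, l).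
  dual-vector : ∀ k l → k ≢ l → Σ (Vect F n) λ e → (form k e ≈ 1#) × (form l e ≈ 0#)
  dual-vector k l k≢l =
    let (x , lx≈0 , kx≉0) = distinct l k (λ l≡k → k≢l (≡-sym l≡k))
        (w , kx*w≈1)      = inverse (form k x) kx≉0
    in  (λ t → w * x t)
      , trans (dot-* (normal k) x w) (trans (*-comm _ _) kx*w≈1)
      , trans (dot-* (normal l) x w) (trans (*-cong refl lx≈0) (zeroʳ w))

  j≢i : j ≢ i
  j≢i j≡i = i≢j (≡-sym j≡i)

  e₁ e₂ : Vect F n
  e₁ = proj₁ (dual-vector i j i≢j)
  e₂ = proj₁ (dual-vector j i j≢i)

  -- coefficients of the form of H_k in the pencil
  α β : Fin m → Carrier
  α k = form k e₁
  β k = form k e₂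

  α-dual : (α i ≈ 1#) × (α j ≈ 0#)
  α-dual = proj₂ (dual-vector i j i≢j)

  β-dual : (β j ≈ 1#) × (β i ≈ 0#)
  β-dual = proj₂ (dual-vector j i j≢i)

  -- Every form of the pencil is determined by f_i and f_j: the difference of
  -- x and (f_i x) e₁ + (f_j x) e₂ lies on X.
  decompose : ∀ k → OnX k → ∀ x → form k x ≈ (α k * form i x) + (β k * form j x)
  decompose k k∈X x = x∙y⁻¹≈ε⇒x≈y _ _ (begin
      form k x - ((α k * form i x) + (β k * form j x)) ≈⟨ +-cong refl (-‿cong (sym form-y)) ⟩
      form k x - form k y                              ≈⟨ sym (dot-difference (normal k) x y) ⟩
      form k z                                         ≈⟨ k∈X z (on-kernel i i-y) (on-kernel j j-y) ⟩
      0#                                               ∎)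
    where
    open import Relation.Binary.Reasoning.Setoid setoid
    y z : Vect F n
    y t = (form i x * e₁ t) + (form j x * e₂ t)
    z t = x t - y t
    form-y′ : ∀ l → form l y ≈ (form i x * α l) + (form j x * β l)
    form-y′ l = dot-linearʳ (normal l) e₁ e₂ (form i x) (form j x)
    form-y : form k y ≈ (α k * form i x) + (β k * form j x)
    form-y = trans (form-y′ k) (+-cong (*-comm _ _) (*-comm _ _))
    i-y : form i y ≈ form i x
    i-y = trans (form-y′ i) (trans (+-cong (trans (*-cong refl (proj₁ α-dual)) (*-identityʳ _))
                                           (trans (*-cong refl (proj₂ β-dual)) (zeroʳ _)))
                                   (+-identityʳ _))
    j-y : form j y ≈ form j x
    j-y = trans (form-y′ j) (trans (+-cong (trans (*-cong refl (proj₂ α-dual)) (zeroʳ _))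
                                           (trans (*-cong refl (proj₁ β-dual)) (*-identityʳ _)))
                                   (+-identityˡ _))
    on-kernel : ∀ l → form l y ≈ form l x → form l z ≈ 0#
    on-kernel l e = trans (dot-difference (normal l) x y) (trans (+-cong refl (-‿cong e)) (-‿inverseʳ _))

  -- Membership in the pencil is decidable: H_k contains X iff its normal is
  -- α_k n_i + β_k n_j, a coordinatewise check.
  OnX? : ∀ k → Dec (OnX k)
  OnX? k = map′ combination⇒OnX OnX⇒combination (all? λ t → normal k t ≟ _)
    where
    Combination : Set ℓ₁
    Combination = ∀ t → normal k t ≈ ((α k * normal i t) + (β k * normal j t))
    combination⇒OnX : Combination → OnX k
    combination⇒OnX comb x x∈Hi x∈Hj =
      trans (dot-cong comb (λ _ → refl))
        (trans (dot-linearˡ (normal i) (normal j) x (α k) (β k))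
          (trans (+-cong (trans (*-cong refl x∈Hi) (zeroʳ _)) (trans (*-cong refl x∈Hj) (zeroʳ _)))
                 (+-identityʳ 0#)))
    OnX⇒combination : OnX k → Combination
    OnX⇒combination k∈X t =
      trans (sym (dot-unit (normal k) t))
        (trans (decompose k k∈X (unit t))
               (+-cong (*-cong refl (dot-unit (normal i) t)) (*-cong refl (dot-unit (normal j) t))))

  module AngularOrderFrom (b : Vect F n) (b-chamber : ChamberPt F 𝒜 b) where
    -- Coefficients rescaled by f_k(b), so that g_k(b) = f_k(b)² > 0: every
    -- hyperplane of the pencil is oriented with b on its positive side.
    A B : Fin m → Carrier
    A k = form k b * α k
    B k = form k b * β k

    g : Fin m → Vect F n → Carrier
    g k x = (A k * form i x) + (B k * form j x)

    g-product : ∀ k → OnX k → ∀ x → (form k b * form k x) ≈ g k x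
    g-product k k∈X x = trans (*-cong refl (decompose k k∈X x))
      (solve 5 (λ fb a u β v → fb :* (a :* u :+ β :* v) := (fb :* a) :* u :+ (fb :* β) :* v) refl
             (form k b) (α k) (form i x) (β k) (form j x))

    g-base-pos : ∀ k → OnX k → 0# < g k b
    g-base-pos k k∈X = <-respʳ (g-product k k∈X b) (square-pos (b-chamber k))

    Chamber : Set (c ⊔ ℓ₁)
    Chamber = Σ (Vect F n) (ChamberPtIn F 𝒜 OnX)

    S : Chamber → Fin m → Set ℓ₂
    S d k = Sep F 𝒜 b (proj₁ d) k

    sep⇒g-neg : ∀ d k → OnX k → S d k → g k (proj₁ d) < 0#
    sep⇒g-neg d k k∈X = <-respˡ (g-product k k∈X (proj₁ d))

    g-neg⇒sep : ∀ d k → OnX k → g k (proj₁ d) < 0# → S d k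
    g-neg⇒sep d k k∈X = <-respˡ (sym (g-product k k∈X (proj₁ d)))

    ¬sep⇒g-pos : ∀ d k → OnX k → ¬ S d k → 0# < g k (proj₁ d)
    ¬sep⇒g-pos d k k∈X ¬s = nonneg-nonzero⇒pos (λ q → ¬s (g-neg⇒sep d k k∈X q))
      (λ e → nonzero*nonzero (b-chamber k) (proj₂ d k k∈X) (trans (g-product k k∈X (proj₁ d)) e))

    _≺_ : Fin m → Fin m → Set ℓ₂
    k ≺ l = (A l * B k) < (A k * B l)

    -- The three-term (Plücker) relation between the g's of three hyperplanes,
    --   det(l,o) g_k + det(o,k) g_l + det(k,l) g_o = 0,
    -- with the negative parts moved to the right.
    plücker : ∀ k l o x →
      ((((A l * B o) * g k x) + ((A o * B k) * g l x)) + ((A k * B l) * g o x))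
      ≈ ((((A o * B l) * g k x) + ((A k * B o) * g l x)) + ((A l * B k) * g o x))
    plücker k l o x =
      solve 8 (λ ak bk al bl ao bo u v →
          ((al :* bo) :* (ak :* u :+ bk :* v) :+ (ao :* bk) :* (al :* u :+ bl :* v)) :+ (ak :* bl) :* (ao :* u :+ bo :* v)
        := ((ao :* bl) :* (ak :* u :+ bk :* v) :+ (ak :* bo) :* (al :* u :+ bl :* v)) :+ (al :* bk) :* (ao :* u :+ bo :* v))
        refl (A k) (B k) (A l) (B l) (A o) (B o) (form i x) (form j x)

    right-not-below : ∀ k l o x →
      ((A o * B l) * g k x) < ((A l * B o) * g k x) → ((A k * B o) * g l x) ≤ ((A o * B k) * g l x) →
      ((A l * B k) * g o x) < ((A k * B l) * g o x) → ⊥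
    right-not-below k l o x p q r = <-irrefl (sym (plücker k l o x)) (+-mono-<-≤-< p q r)

    left-not-below : ∀ k l o x →
      ((A l * B o) * g k x) < ((A o * B l) * g k x) → ((A o * B k) * g l x) ≤ ((A k * B o) * g l x) →
      ((A k * B l) * g o x) < ((A l * B k) * g o x) → ⊥
    left-not-below k l o x p q r = <-irrefl (plücker k l o x) (+-mono-<-≤-< p q r)

    ≺-trans : ∀ k l o → OnX k → OnX l → OnX o → k ≺ l → l ≺ o → k ≺ o
    ≺-trans k l o k∈X l∈X o∈X k≺l l≺o with compare (A o * B k) (A k * B o)
    ... | tri< k≺o _ _ = k≺o
    ... | tri≈ _ e _ = ⊥-elim (right-not-below k l o b (*-monoˡ-<-pos l≺o (g-base-pos k k∈X))
                          (*-monoˡ-≤-pos (inj₂ (sym e)) (g-base-pos l l∈X)) (*-monoˡ-<-pos k≺l (g-base-pos o o∈X)))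
    ... | tri> _ _ q = ⊥-elim (right-not-below k l o b (*-monoˡ-<-pos l≺o (g-base-pos k k∈X))
                          (*-monoˡ-≤-pos (inj₁ q) (g-base-pos l l∈X)) (*-monoˡ-<-pos k≺l (g-base-pos o o∈X)))

    no-out-in-out : ∀ d k l o → OnX k → OnX l → OnX o → k ≺ l → l ≺ o →
                    ¬ S d k → S d l → ¬ S d o → ⊥
    no-out-in-out d k l o k∈X l∈X o∈X k≺l l≺o ¬sk sl ¬so =
      right-not-below k l o (proj₁ d)
        (*-monoˡ-<-pos l≺o (¬sep⇒g-pos d k k∈X ¬sk))
        (inj₁ (*-monoˡ-<-neg (≺-trans k l o k∈X l∈X o∈X k≺l l≺o) (sep⇒g-neg d l l∈X sl)))
        (*-monoˡ-<-pos k≺l (¬sep⇒g-pos d o o∈X ¬so))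

    no-in-out-in : ∀ d k l o → OnX k → OnX l → OnX o → k ≺ l → l ≺ o →
                   S d k → ¬ S d l → S d o → ⊥
    no-in-out-in d k l o k∈X l∈X o∈X k≺l l≺o sk ¬sl so =
      left-not-below k l o (proj₁ d)
        (*-monoˡ-<-neg l≺o (sep⇒g-neg d k k∈X sk))
        (inj₁ (*-monoˡ-<-pos (≺-trans k l o k∈X l∈X o∈X k≺l l≺o) (¬sep⇒g-pos d l l∈X ¬sl)))
        (*-monoˡ-<-neg k≺l (sep⇒g-neg d o o∈X so))

    -- Hyperplanes with det(k,l) = 0 have proportional g's, so no chamber
    -- separates them from b differently.
    tied : ∀ k l → OnX k → OnX l → (A l * B k) ≈ (A k * B l) →
           ∀ d → (S d k → S d l) × (S d l → S d k)
    tied k l k∈X l∈X det≈0 d =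
      (λ s → g-neg⇒sep d l l∈X (pos-factor-neg (g-base-pos k k∈X)
               (<-respˡ (sym (cross x)) (pos*neg (g-base-pos l l∈X) (sep⇒g-neg d k k∈X s))))) ,
      (λ s → g-neg⇒sep d k k∈X (pos-factor-neg (g-base-pos l l∈X)
               (<-respˡ (cross x) (pos*neg (g-base-pos k k∈X) (sep⇒g-neg d l l∈X s)))))
      where
      x : Vect F n
      x = proj₁ d
      -- g_k(b) g_l(x) − g_l(b) g_k(x) = det(k,l) (f_i b f_j x − f_j b f_i x)
      exchange : ∀ ak bk al bl w₁ w₂ z₁ z₂ →
        ((((ak * w₁) + (bk * w₂)) * ((al * z₁) + (bl * z₂))) + (((al * bk) * (w₁ * z₂)) + ((ak * bl) * (w₂ * z₁))))
        ≈ ((((al * w₁) + (bl * w₂)) * ((ak * z₁) + (bk * z₂))) + (((ak * bl) * (w₁ * z₂)) + ((al * bk) * (w₂ * z₁))))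
      exchange = solve 8 (λ ak bk al bl w₁ w₂ z₁ z₂ →
          (ak :* w₁ :+ bk :* w₂) :* (al :* z₁ :+ bl :* z₂) :+ ((al :* bk) :* (w₁ :* z₂) :+ (ak :* bl) :* (w₂ :* z₁))
        := (al :* w₁ :+ bl :* w₂) :* (ak :* z₁ :+ bk :* z₂) :+ ((ak :* bl) :* (w₁ :* z₂) :+ (al :* bk) :* (w₂ :* z₁)))
        refl
      cross : ∀ x → (g k b * g l x) ≈ (g l b * g k x)
      cross x = +-cancelʳ _ _ _
        (trans (+-cong refl (+-cong refl (*-cong det≈0 refl)))
          (trans (exchange (A k) (B k) (A l) (B l) (form i b) (form j b) (form i x) (form j x))
                 (+-cong refl (+-cong (*-cong (sym det≈0) refl) refl))))

    trichotomy : ∀ k l → OnX k → OnX l →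
                 k ≺ l ⊎ (l ≺ k ⊎ (∀ d → (S d k → S d l) × (S d l → S d k)))
    trichotomy k l k∈X l∈X with compare (A l * B k) (A k * B l)
    ... | tri< k≺l _ _ = inj₁ k≺l
    ... | tri≈ _ e _   = inj₂ (inj₂ (tied k l k∈X l∈X e))
    ... | tri> _ _ l≺k = inj₂ (inj₁ l≺k)

    angular-order : RankTwo.AngularOrder m (c ⊔ ℓ₁) (c ⊔ ℓ₁) ℓ₂ ℓ₂
    angular-order = record
      { P = OnX ; P? = OnX? ; Chamber = Chamber ; S = S ; S? = λ d k → _ <? _
      ; _≺_ = _≺_ ; _≺?_ = λ k l → _ <? _ ; trichotomy = trichotomy
      ; no-out-in-out = no-out-in-out ; no-in-out-in = no-in-out-in
      ; base = b , (λ k _ → b-chamber k) ; base-empty = λ k _ → sep-irrefl b k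
      ; opposite = antipode b , antipode-chamber (λ k _ → b-chamber k)
      ; opposite-full = λ k _ → sep-antipode b k (b-chamber k) }

-- Biclosed sets are exactly the sets that are, on every pencil 𝒜_X, the
-- separation set of a chamber of 𝒜_X; and that description is compatible
-- with changing the base chamber.
module Biclosure {c ℓ₁ ℓ₂ : Level} (F : OrderedField c ℓ₁ ℓ₂) {n m : ℕ} (𝒜 : Arrangement F n m) where
  open OrderedField F using (_≈_; 0#)
  open OrderedFieldFacts F using (_<?_)
  open Separation F 𝒜
  open ExclusiveOr

  Agrees : ∀ {p q} → Pred (Fin m) p → Pred (Fin m) q → Vect F n → Vect F n → Set (p ⊔ q ⊔ ℓ₂)
  Agrees P J b d = ∀ H → P H → J H ⇔ Sep F 𝒜 b d H

  PencilwiseSeparation : ∀ {q} → Pred (Fin m) q → Vect F n → Set (c ⊔ ℓ₁ ⊔ ℓ₂ ⊔ q)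
  PencilwiseSeparation J b =
    ∀ i j → i ≢ j → Σ (Vect F n) λ d → ChamberPtIn F 𝒜 (𝒜X F 𝒜 i j) d × Agrees (𝒜X F 𝒜 i j) J b d

  sep? : ∀ x y k → Dec (Sep F 𝒜 x y k)
  sep? x y k = _ <? _

  ∆-sep? : ∀ {q} {J : Pred (Fin m) q} {b c} → Decidable J → Decidable (_∆_ F 𝒜 J (Sep F 𝒜 b c))
  ∆-sep? {b = b} {c} J? H = (J? H ×-dec ¬? (sep? b c H)) ⊎-dec (¬? (J? H) ×-dec sep? b c H)

  -- A separation set S_P(b,d) is convex in P (the antipode of d witnesses
  -- each hyperplane outside it) ...
  separation-convex : ∀ {p q} (P : Pred (Fin m) p) (J : Pred (Fin m) q) {b d} →
    ChamberPtIn F 𝒜 P b → ChamberPtIn F 𝒜 P d → Agrees P J b d → ConvexIn F 𝒜 P (J ∩ P) b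
  separation-convex P J {b} {d} b∈ d∈ agree H pH H∉J =
      antipode d , antipode-chamber d∈
    , (pH , ¬sep⇒sep-antipode b d H (b∈ H pH) (d∈ H pH) (λ s → H∉J (Equivalence.from (agree H pH) s , pH)))
    , λ H′ (pH′ , s′) → pH′ , λ (jH′ , _) → sep-antipode⇒¬sep b d H′ s′ (Equivalence.to (agree H′ pH′) jH′)

  -- ... and so is its complement (d itself witnesses each hyperplane in it).
  separation-coconvex : ∀ {p q} (P : Pred (Fin m) p) (J : Pred (Fin m) q) {b d} →
    ChamberPtIn F 𝒜 P d → Agrees P J b d → ConvexIn F 𝒜 P (∁ J ∩ P) b
  separation-coconvex P J {b} {d} d∈ agree H pH H∉∁J =
      d , d∈ , (pH , sep-bdH)
    , λ H′ (pH′ , s′) → pH′ , λ (¬jH′ , _) → ¬jH′ (Equivalence.from (agree H′ pH′) s′)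
    where
    sep-bdH : Sep F 𝒜 b d H
    sep-bdH = decidable-stable (sep? b d H) (λ ¬s → H∉∁J ((λ j → ¬s (Equivalence.to (agree H pH) j)) , pH))

  pencilwise⇒biclosed : ∀ {q} {J : Pred (Fin m) q} {b} → ChamberPt F 𝒜 b →
                        PencilwiseSeparation J b → Biclosed F 𝒜 J b
  pencilwise⇒biclosed {J = J} b-chamber separation =
      (λ i j i≢j → let (d , d∈ , agree) = separation i j i≢j
                   in separation-convex (𝒜X F 𝒜 i j) J (λ k _ → b-chamber k) d∈ agree)
    , (λ i j i≢j → let (d , d∈ , agree) = separation i j i≢j
                   in separation-coconvex (𝒜X F 𝒜 i j) J d∈ agree)

  -- Conversely, on a pencil the two convexity conditions say that J and its
  -- complement are unions of separation sets, so the rank-two analysis applies.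
  biclosed⇒pencilwise : ∀ {q} {J : Pred (Fin m) q} {b} → Decidable J → ChamberPt F 𝒜 b →
                        Biclosed F 𝒜 J b → PencilwiseSeparation J b
  biclosed⇒pencilwise {J = J} {b} J? b-chamber (closed , coclosed) i j i≢j =
    let ((d , d∈) , J⊆S , S⊆J) =
          RankTwo.covered-separation-set angular-order J J?
            (covered (coclosed i j i≢j)) (complement-covered (closed i j i≢j))
    in d , d∈ , λ H pH → mk⇔ (J⊆S H pH) (S⊆J H pH)
    where
    open Pencil F 𝒜 i j i≢j
    open AngularOrderFrom b b-chamber
    open RankTwo.Segments angular-order using (Covered)

    complement-covered : ConvexIn F 𝒜 OnX (J ∩ OnX) b → Covered (λ H → ¬ J H)
    complement-covered convex H pH ¬jH =
      let (d , d∈ , (_ , s) , inside) = convex H pH (λ (jH , _) → ¬jH jH)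
      in (d , d∈) , s , λ H′ pH′ s′ jH′ → proj₂ (inside H′ (pH′ , s′)) (jH′ , pH′)

    covered : ConvexIn F 𝒜 OnX (∁ J ∩ OnX) b → Covered J
    covered convex H pH jH =
      let (d , d∈ , (_ , s) , inside) = convex H pH (λ (¬jH , _) → ¬jH jH)
      in (d , d∈) , s ,
         λ H′ pH′ s′ → decidable-stable (J? H′) (λ ¬jH′ → proj₂ (inside H′ (pH′ , s′)) (¬jH′ , pH′))

  biclosed⇔pencilwise : ∀ {q} {J : Pred (Fin m) q} {b} → Decidable J → ChamberPt F 𝒜 b →
                        Biclosed F 𝒜 J b ⇔ PencilwiseSeparation J b
  biclosed⇔pencilwise J? b-chamber = mk⇔ (biclosed⇒pencilwise J? b-chamber) (pencilwise⇒biclosed b-chamber)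

  -- Changing the base chamber from b to c:  S(c,d) = S(b,c) ∆ S(b,d), so
  -- J agrees with S(b,d) iff J ∆ S(b,c) agrees with S(c,d).
  rebase : ∀ {q} {J : Pred (Fin m) q} {b c} → Decidable J → ChamberPt F 𝒜 b → ChamberPt F 𝒜 c →
           PencilwiseSeparation J b ⇔ PencilwiseSeparation (_∆_ F 𝒜 J (Sep F 𝒜 b c)) c
  rebase {q} {J} {b} {c} J? b-chamber c-chamber = mk⇔ forward backward
    where
    K : Pred (Fin m) (q ⊔ ℓ₂)
    K = _∆_ F 𝒜 J (Sep F 𝒜 b c)

    sep-via-b : ∀ d H → ¬ (form H d ≈ 0#) → Sep F 𝒜 c d H ⇔ (Sep F 𝒜 b c H ⊕ Sep F 𝒜 b d H)
    sep-via-b d H = sep⇔⊕ b c d H (b-chamber H) (c-chamber H)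

    forward : PencilwiseSeparation J b → PencilwiseSeparation K c
    forward separation i j i≢j =
      let (d , d∈ , agree) = separation i j i≢j
      in d , d∈ , λ H pH → ⇔-sym (sep-via-b d H (d∈ H pH)) ⇔-∘ ⊕-shift (agree H pH)

    backward : PencilwiseSeparation K c → PencilwiseSeparation J b
    backward separation i j i≢j =
      let (d , d∈ , agree) = separation i j i≢j
      in d , d∈ , λ H pH → ⊕-unshift (sep? b c H) (sep? b d H) (J? H)
                             (sep-via-b d H (d∈ H pH) ⇔-∘ agree H pH)

-- Both sides are equivalent to pencilwise separation statements, which
-- correspond to each other under the change of base chamber from c₀ to c.
lemma3p3 : ∀ {c ℓ₁ ℓ₂ : Level} (F : OrderedField c ℓ₁ ℓ₂) {n m : ℕ}
           (𝒜 : Arrangement F n m) (c₀ c : Vect F n) →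
           ChamberPt F 𝒜 c₀ → ChamberPt F 𝒜 c → (I : Subset m) →
           Biclosed F 𝒜 (_∈ I) c₀ ⇔ Biclosed F 𝒜 (_∆_ F 𝒜 (_∈ I) (Sep F 𝒜 c₀ c)) c
lemma3p3 F 𝒜 c₀ c c₀-chamber c-chamber I =
  ⇔-sym (biclosed⇔pencilwise (∆-sep? (_∈? I)) c-chamber)
    ⇔-∘ (rebase (_∈? I) c₀-chamber c-chamber
    ⇔-∘ biclosed⇔pencilwise (_∈? I) c₀-chamber)
  where open Biclosure F 𝒜
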